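{- Let $P$ be a partial field. Then its GRS-lift $\mathcal L_{\mathcal G}P$ is a mock partial field, and there is an isomorphism $\theta:\Pi(\mathcal L_{\mathcal G}P)\to\mathcal L_{\mathcal P}P$ such that $\lambda_{\mathcal G,P}=\lambda_{\mathcal P,P}\circ\theta\circ\pi_{\mathcal L_{\mathcal G}P}$.
   Context: A pasture is a commutative monoid $P$ (written multiplicatively, identity $1$) with an absorbing element $0$ such that $P^\times=P\setminus\{0\}$ is a group, together with a nullset $N_P\subseteq\mathrm{Sym}_3(P)$ ($P^3$ modulo permutations, class of $(a,b,c)$ written $a+b+c$) such that $a+0+0\in N_P$ iff $a=0$, $N_P$ is stable under multiplication by $P^\times$, and there is a unique $-1\in P^\times$ with $1+(-1)+0\in N_P$. Write $a+b=c$ or $a+b-c\in N_P$ for $a+b+(-c)\in N_P$. Morphisms are multiplicative maps preserving $0$, $1$ and nullsets. $\mathbb F_1^\pm=\{0,\pm1\}$ with nullset $\{0+0+0,1+(-1)+0\}$. The universal ring of $P$ is $R_P=\mathbb Z[P^\times]/\langle N_P\rangle$ ($0\in P$ identified with $0$; $\langle N_P\rangle$ the ideal generated by all null $a+b+c$). $P$ is a partial field if $P\to R_P$ is injective and every $a+b+c$ ($a,b,c\in P$) vanishing in $R_P$ lies in $N_P$; such $P$ is identified with the pair $(P^\times,R_P)$. A mock partial field is a pasture with $R_P\ne0$; its associated partial field $\Pi(P)$ is $G\cup\{0\}$, $G$ the image of $P^\times$ in $R_P$, with nullset all $a+b+c$ vanishing in $R_P$, and $\pi_P:P\to\Pi(P)$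 is the induced surjective morphism. Presentations: for symbols $\{t_i\}$ and relations $S$ (each of the form $\alpha+\beta+\gamma\in N$ with $\alpha,\beta,\gamma$ equal to $0$ or $\pm$ Laurent monomials in the $t_i$, at least two nonzero; $m=\pm1$ encodes $m+(\mp1)+0\in N$), $\mathbb F_1^\pm\langle t_i\rangle/\!\!/S$ is the pasture $L$ with $t_i\in L^\times$ satisfying $S$, universal for families in any pasture $Q$ satisfying $S$ in $N_Q$. A fundamental element of $P$ is $a\in P^\times$ with $a+b-1\in N_P$ for some $b\in P^\times$; $P^\circ$ is the set of them. The GRS-lift is $\mathcal L_{\mathcal G}P=\mathbb F_1^\pm\langle t_a\mid a\in P^\circ\rangle/\!\!/S$, with $S$: (G1) $1+1+0\in N$ if $-1=1$ in $P$; (G2) $t_at_{a^{ -1}}=1$ for $a\in P^\circ$; (G3) $t_a+t_b-1\in N$ whenever $a+b-1\in N_P$; (G4) $t_at_bt_c=-1$ whenever $a,b,c\in P^\circ$, $a+b^{ -1}-1\in N_P$ and $abc=-1$; (G5) $t_at_bt_c=1$ whenever $a,b,c\in P^\circ$ and $abc=1$; and $\lambda_{\mathcal G,P}:\mathcal L_{\mathcal G}P\to P$, $t_a\mapsto a$. For a partial field $P$, the Pendavingh–van Zwam lift $\mathcal L_{\mathcal P}P$ is the partial field $(G',R')$ where $R'=\mathbb Z[t_a^{\pm1}\mid a\in P^\circ]/I$ with $I$ generated by: $1+1$ if $-1=1$ in $P$; $t_at_{a^{ -1}}-1$ for $a\in P^\circ$; $t_a+t_b-1$ whenever $a+b-1\in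 N_P$; $t_at_bt_c-1$ whenever $a,b,c\in P^\circ$ and $abc=1$ in $P$; and $G'$ is the subgroup of $R'^\times$ generated by $-1$ and the $t_a$. It comes with the morphism $\lambda_{\mathcal P,P}:\mathcal L_{\mathcal P}P\to P$, $t_a\mapsto a$. -}

module Defs where

open import Data.Maybe using (Maybe; just; nothing)
open import Data.Product using (Σ; _×_; _,_; proj₁)
open import Data.Sum using (_⊎_; inj₁; inj₂)
open import Relation.Nullary using (¬_)
open import Relation.Binary.Structures using (IsEquivalence)

-- Raw pasture data: a setoid carrier (elements of P up to _≈_),
-- multiplication, 1, 0 and a nullset N (a predicate on triples;
-- N a b c stands for "a + b + c ∈ N_P").

record PastureData : Set₁ where
  field
    Carrier : Set
    _≈_     : Carrier → Carrier → Set
    _·_     : Carrier → Carrier → Carrier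
    1#      : Carrier
    0#      : Carrier
    N       : Carrier → Carrier → Carrier → Set

record Pasture : Set₁ where
  field
    pd : PastureData
  open PastureData pd public
  field
    ≈-isEquivalence : IsEquivalence _≈_
    ·-cong   : ∀ {a a' b b'} → a ≈ a' → b ≈ b' → (a · b) ≈ (a' · b')
    ·-assoc  : ∀ a b c → ((a · b) · c) ≈ (a · (b · c))
    ·-comm   : ∀ a b → (a · b) ≈ (b · a)
    ·-identityˡ : ∀ a → (1# · a) ≈ a
    ·-zeroˡ  : ∀ a → (0# · a) ≈ 0#
    -- P^× = P ∖ {0} is a group (1 ∈ P^×, inverses; closure follows)
    1≉0      : ¬ (1# ≈ 0#)
    _⁻¹      : Carrier → Carrier
    ⁻¹-inverse : ∀ a → ¬ (a ≈ 0#) → (a · (a ⁻¹)) ≈ 1#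
    -- N is a subset of Sym₃(P), compatible with the setoid equality
    N-resp   : ∀ {a a' b b' c c'} → a ≈ a' → b ≈ b' → c ≈ c' → N a b c → N a' b' c'
    N-swap₁₂ : ∀ {a b c} → N a b c → N b a c
    N-swap₂₃ : ∀ {a b c} → N a b c → N a c b
    N-zero⇒  : ∀ {a} → N a 0# 0# → a ≈ 0#
    N-zero⇐  : ∀ {a} → a ≈ 0# → N a 0# 0#
    N-scale  : ∀ {u a b c} → ¬ (u ≈ 0#) → N a b c → N (u · a) (u · b) (u · c)
    neg      : Carrier
    neg≉0    : ¬ (neg ≈ 0#)
    N-neg    : N 1# neg 0#
    neg-unique : ∀ {x} → ¬ (x ≈ 0#) → N 1# x 0# → x ≈ neg

-- Commutative rings presented by generators and relations:
-- the free commutative ring on X modulo the ideal generated by Rel.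

data RTerm (X : Set) : Set where
  gen      : X → RTerm X
  0r 1r    : RTerm X
  _+r_ _*r_ : RTerm X → RTerm X → RTerm X
  -r_      : RTerm X → RTerm X

infixl 6 _+r_
infixl 7 _*r_

module _ {X : Set} (Rel : RTerm X → RTerm X → Set) where
  data RingEq : RTerm X → RTerm X → Set where
    rel      : ∀ {a b} → Rel a b → RingEq a b
    r-refl   : ∀ {a} → RingEq a a
    r-sym    : ∀ {a b} → RingEq a b → RingEq b a
    r-trans  : ∀ {a b c} → RingEq a b → RingEq b c → RingEq a c
    +-cong   : ∀ {a a' b b'} → RingEq a a' → RingEq b b' → RingEq (a +r b) (a' +r b')
    *-cong   : ∀ {a a' b b'} → RingEq a a' → RingEq b b' → RingEq (a *r b) (a' *r b')
    neg-cong : ∀ {a a'} → RingEq a a' → RingEq (-r a) (-r a')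
    +-assoc  : ∀ a b c → RingEq ((a +r b) +r c) (a +r (b +r c))
    +-comm   : ∀ a b → RingEq (a +r b) (b +r a)
    +-idˡ    : ∀ a → RingEq (0r +r a) a
    +-invˡ   : ∀ a → RingEq ((-r a) +r a) 0r
    *-assoc  : ∀ a b c → RingEq ((a *r b) *r c) (a *r (b *r c))
    *-comm   : ∀ a b → RingEq (a *r b) (b *r a)
    *-idˡ    : ∀ a → RingEq (1r *r a) a
    distribˡ : ∀ a b c → RingEq (a *r (b +r c)) ((a *r b) +r (a *r c))

-- Universal ring R_P = Z[P^×]/⟨N_P⟩ of (raw) pasture data.

module Universal (D : PastureData) where
  open PastureData D

  data URel : RTerm Carrier → RTerm Carrier → Set where
    ur-cong : ∀ {a b} → a ≈ b → URel (gen a) (gen b)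
    ur-mul  : ∀ a b → URel (gen (a · b)) (gen a *r gen b)
    ur-one  : URel (gen 1#) 1r
    ur-zero : URel (gen 0#) 0r
    ur-null : ∀ {a b c} → N a b c → URel (gen a +r gen b +r gen c) 0r

  _≈R_ : RTerm Carrier → RTerm Carrier → Set
  _≈R_ = RingEq URel

  IsPartialField : Set
  IsPartialField =
    (∀ a b → gen a ≈R gen b → a ≈ b) ×
    (∀ a b c → (gen a +r gen b +r gen c) ≈R 0r → N a b c)

  IsMockPartialField : Set
  IsMockPartialField = ¬ (1r ≈R 0r)

  -- Associated partial field Π(P): same underlying elements, equality and
  -- nullset computed in R_P; π_P is the identity on representatives.
  Π : PastureData
  Π = record
    { Carrier = Carrier
    ; _≈_ = λ a b → gen a ≈R gen b
    ; _·_ = _·_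
    ; 1# = 1#
    ; 0# = 0#
    ; N = λ a b c → (gen a +r gen b +r gen c) ≈R 0r
    }

  π : Carrier → PastureData.Carrier Π
  π a = a

open Universal public using (IsPartialField; IsMockPartialField; Π; π)

record IsMorphism (D E : PastureData) (f : PastureData.Carrier D → PastureData.Carrier E) : Set where
  private
    module D = PastureData D
    module E = PastureData E
  field
    f-cong : ∀ {a b} → a D.≈ b → f a E.≈ f b
    f-mul  : ∀ a b → f (a D.· b) E.≈ (f a E.· f b)
    f-one  : f D.1# E.≈ E.1#
    f-zero : f D.0# E.≈ E.0#
    f-null : ∀ {a b c} → D.N a b c → E.N (f a) (f b) (f c)

record IsIsomorphism (D E : PastureData) (f : PastureData.Carrier D → PastureData.Carrier E) : Set where
  private
    module D = PastureData D
    module E = PastureData E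
  field
    morphism   : IsMorphism D E f
    inverse    : PastureData.Carrier E → PastureData.Carrier D
    inverse-morphism : IsMorphism E D inverse
    inverseˡ   : ∀ x → f (inverse x) E.≈ x
    inverseʳ   : ∀ x → inverse (f x) D.≈ x

module Lifts (P : Pasture) where
  open Pasture P

  IsFundamental : Carrier → Set
  IsFundamental a = ¬ (a ≈ 0#) × Σ Carrier (λ b → ¬ (b ≈ 0#) × N a b neg)

  Fund : Set
  Fund = Σ Carrier IsFundamental

  -- signed Laurent monomials in the symbols t_a (a ∈ P°)
  data Mono : Set where
    1m -1m : Mono
    tm     : Fund → Mono
    _·m_   : Mono → Mono → Mono
    invm   : Mono → Mono

  -- elements: 0 (nothing) or a monomial
  Elt : Set
  Elt = Maybe Mono

  _*M_ : Elt → Elt → Elt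
  just m *M just n = just (m ·m n)
  _      *M _      = nothing

  -- the relations S of the GRS-lift, as null triples (G1)–(G5)
  data GRel : Elt → Elt → Elt → Set where
    G1 : neg ≈ 1# → GRel (just 1m) (just 1m) nothing
    G2 : ∀ {a} (p : IsFundamental a) (q : IsFundamental (a ⁻¹)) →
         GRel (just (tm (a , p) ·m tm (a ⁻¹ , q))) (just -1m) nothing
    G3 : ∀ {a b} (p : IsFundamental a) (q : IsFundamental b) → N a b neg →
         GRel (just (tm (a , p))) (just (tm (b , q))) (just -1m)
    G4 : ∀ {a b c} (p : IsFundamental a) (q : IsFundamental b) (r : IsFundamental c) →
         N a (b ⁻¹) neg → ((a · b) · c) ≈ neg →
         GRel (just ((tm (a , p) ·m tm (b , q)) ·m tm (c , r))) (just 1m) nothing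
    G5 : ∀ {a b c} (p : IsFundamental a) (q : IsFundamental b) (r : IsFundamental c) →
         ((a · b) · c) ≈ 1# →
         GRel (just ((tm (a , p) ·m tm (b , q)) ·m tm (c , r))) (just -1m) nothing

  -- The presented pasture F₁^±⟨t_a | a ∈ P°⟩//S: equality of monomials and
  -- nullset are the least ones closed under the pasture axioms and S.
  data _≈G_ : Mono → Mono → Set
  data _≈E_ : Elt → Elt → Set
  data NG : Elt → Elt → Elt → Set

  data _≈G_ where
    g-refl   : ∀ {m} → m ≈G m
    g-sym    : ∀ {m n} → m ≈G n → n ≈G m
    g-trans  : ∀ {m n o} → m ≈G n → n ≈G o → m ≈G o
    g-·-cong : ∀ {m m' n n'} → m ≈G m' → n ≈G n' → (m ·m n) ≈G (m' ·m n')
    g-inv-cong : ∀ {m m'} → m ≈G m' → invm m ≈G invm m'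
    g-assoc  : ∀ m n o → ((m ·m n) ·m o) ≈G (m ·m (n ·m o))
    g-comm   : ∀ m n → (m ·m n) ≈G (n ·m m)
    g-idˡ    : ∀ m → (1m ·m m) ≈G m
    g-invˡ   : ∀ m → (invm m ·m m) ≈G 1m
    g-negneg : (-1m ·m -1m) ≈G 1m
    -- t_a depends only on the element a ∈ P (P is a setoid)
    g-gen    : ∀ {a a'} (p : IsFundamental a) (p' : IsFundamental a') → a ≈ a' →
               tm (a , p) ≈G tm (a' , p')
    -- in a pasture, m + n + 0 ∈ N forces n = -m
    g-null   : ∀ {m n} → NG (just m) (just n) nothing → n ≈G (-1m ·m m)

  data _≈E_ where
    e-zero : nothing ≈E nothing
    e-just : ∀ {m n} → m ≈G n → just m ≈E just n

  data NG where
    n-000   : NG nothing nothing nothing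
    n-neg   : NG (just 1m) (just -1m) nothing
    n-rel   : ∀ {x y z} → GRel x y z → NG x y z
    n-scale : ∀ {x y z} u → NG x y z → NG (just u *M x) (just u *M y) (just u *M z)
    n-swap₁₂ : ∀ {x y z} → NG x y z → NG y x z
    n-swap₂₃ : ∀ {x y z} → NG x y z → NG x z y
    n-resp  : ∀ {x x' y z} → x ≈E x' → NG x y z → NG x' y z

  LG : PastureData
  LG = record
    { Carrier = Elt ; _≈_ = _≈E_ ; _·_ = _*M_
    ; 1# = just 1m ; 0# = nothing ; N = NG }

  λm : Mono → Carrier
  λm 1m = 1#
  λm -1m = neg
  λm (tm (a , _)) = a
  λm (m ·m n) = λm m · λm n
  λm (invm m) = λm m ⁻¹

  λE : Elt → Carrier
  λE nothing = 0#
  λE (just m) = λm m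

  λG : PastureData.Carrier LG → Carrier
  λG = λE

  -- Pendavingh–van Zwam lift: R' = Z[t_a^{±1} | a ∈ P°]/I.
  -- Generators inj₁ x = t_a and inj₂ x = t_a^{-1}.
  T : Fund → RTerm (Fund ⊎ Fund)
  T x = gen (inj₁ x)

  data PRel : RTerm (Fund ⊎ Fund) → RTerm (Fund ⊎ Fund) → Set where
    laurent : ∀ x → PRel (gen (inj₁ x) *r gen (inj₂ x)) 1r
    p-gen   : ∀ {a a'} (p : IsFundamental a) (p' : IsFundamental a') → a ≈ a' →
              PRel (T (a , p)) (T (a' , p'))
    P1 : neg ≈ 1# → PRel (1r +r 1r) 0r
    P2 : ∀ {a} (p : IsFundamental a) (q : IsFundamental (a ⁻¹)) →
         PRel (T (a , p) *r T (a ⁻¹ , q) +r (-r 1r)) 0r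
    P3 : ∀ {a b} (p : IsFundamental a) (q : IsFundamental b) → N a b neg →
         PRel (T (a , p) +r T (b , q) +r (-r 1r)) 0r
    P4 : ∀ {a b c} (p : IsFundamental a) (q : IsFundamental b) (r : IsFundamental c) →
         ((a · b) · c) ≈ 1# →
         PRel (T (a , p) *r T (b , q) *r T (c , r) +r (-r 1r)) 0r

  _≈P'_ : RTerm (Fund ⊎ Fund) → RTerm (Fund ⊎ Fund) → Set
  _≈P'_ = RingEq PRel

  -- evaluation of monomials in R' (ev m, and evInv m = ev (m⁻¹))
  ev evInv : Mono → RTerm (Fund ⊎ Fund)
  ev 1m = 1r
  ev -1m = -r 1r
  ev (tm x) = gen (inj₁ x)
  ev (m ·m n) = ev m *r ev n
  ev (invm m) = evInv m
  evInv 1m = 1r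
  evInv -1m = -r 1r
  evInv (tm x) = gen (inj₂ x)
  evInv (m ·m n) = evInv m *r evInv n
  evInv (invm m) = ev m

  evE : Elt → RTerm (Fund ⊎ Fund)
  evE nothing = 0r
  evE (just m) = ev m

  -- L_P P = (G', R') as a pasture: elements G' ∪ {0} (represented by
  -- monomials in -1 and the t_a, and 0), equality and nullset in R'.
  LP : PastureData
  LP = record
    { Carrier = Elt
    ; _≈_ = λ x y → evE x ≈P' evE y
    ; _·_ = _*M_
    ; 1# = just 1m
    ; 0# = nothing
    ; N = λ x y z → (evE x +r evE y +r evE z) ≈P' 0r }

  λP : PastureData.Carrier LP → Carrier
  λP = λE

{-# OPTIONS --safe #-}
-- The map t_a ↦ a is a morphism L_G P → P.  Since P is a partial field, it
-- factors through Π(L_G P), so 1 = 0 in the universal ring of L_G P would give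
-- 1 = 0 in P.  The isomorphism θ is the identity on signed monomials: evaluating
-- t_a in the Pendavingh–van Zwam ring R' respects (G1)–(G5), where (G4) follows
-- from (G2) and (G3) in R'; conversely the generators t_a^{±1} of R' satisfy the
-- defining relations of R' in the universal ring of L_G P.  Both λ-maps send
-- t_a to a, so the triangle commutes on representatives.
module Submission where

open import Defs renaming (+-cong to +r-cong; *-cong to *r-cong; neg-cong to -r-cong; +-assoc to +r-assoc; +-comm to +r-comm; +-idˡ to +r-identityˡ; +-invˡ to -r-inverseˡ; *-assoc to *r-assoc; *-comm to *r-comm; *-idˡ to *r-identityˡ; distribˡ to *r-distribˡ)
open import Level using (0ℓ)
open import Algebra using (CommutativeRing; CommutativeMonoid; AbelianGroup)
open import Algebra.Structures using (IsCommutativeRing)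
import Algebra.Properties.Group as GroupProperties
import Algebra.Properties.AbelianGroup as AbelianGroupProperties
import Algebra.Properties.Ring as RingProperties
import Algebra.Solver.CommutativeMonoid as CommutativeMonoidSolver
open import Tactic.RingSolver.Core.AlmostCommutativeRing using (fromCommutativeRing)
import Tactic.RingSolver.NonReflective as RingSolver
open import Data.Product using (Σ; _×_; _,_; proj₁; proj₂)
open import Data.Maybe using (just; nothing)
open import Data.Sum using (_⊎_; inj₁; inj₂)
open import Function using (id; _∘_)
open import Relation.Nullary using (¬_)
open import Relation.Binary.Structures using (IsEquivalence)
open import Relation.Binary.Bundles using (Setoid)
import Relation.Binary.Reasoning.Setoid as SetoidReasoning

module _ {X : Set} (Rel : RTerm X → RTerm X → Set) where

  RingEq-isCommutativeRing : IsCommutativeRing (RingEq Rel) _+r_ _*r_ -r_ 0r 1r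
  RingEq-isCommutativeRing = record
    { isRing = record
      { +-isAbelianGroup = record
        { isGroup = record
          { isMonoid = record
            { isSemigroup = record
              { isMagma = record
                { isEquivalence = record { refl = r-refl ; sym = r-sym ; trans = r-trans }
                ; ∙-cong = +r-cong }
              ; assoc = +r-assoc }
            ; identity = +r-identityˡ , λ a → r-trans (+r-comm a 0r) (+r-identityˡ a) }
          ; inverse = -r-inverseˡ , λ a → r-trans (+r-comm a (-r a)) (-r-inverseˡ a)
          ; ⁻¹-cong = -r-cong }
        ; comm = +r-comm }
      ; *-cong = *r-cong
      ; *-assoc = *r-assoc
      ; *-identity = *r-identityˡ , λ a → r-trans (*r-comm a 1r) (*r-identityˡ a)
      ; distrib = *r-distribˡ , distribʳ }
    ; *-comm = *r-comm }
    where
    distribʳ : ∀ a b c → RingEq Rel ((b +r c) *r a) ((b *r a) +r (c *r a))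
    distribʳ a b c = r-trans (*r-comm (b +r c) a)
      (r-trans (*r-distribˡ a b c) (+r-cong (*r-comm a b) (*r-comm a c)))

  RingEq-commutativeRing : CommutativeRing 0ℓ 0ℓ
  RingEq-commutativeRing = record { isCommutativeRing = RingEq-isCommutativeRing }

substitute : {X Y : Set} → (X → RTerm Y) → RTerm X → RTerm Y
substitute σ (gen x) = σ x
substitute σ 0r = 0r
substitute σ 1r = 1r
substitute σ (s +r t) = substitute σ s +r substitute σ t
substitute σ (s *r t) = substitute σ s *r substitute σ t
substitute σ (-r s) = -r substitute σ s

module _ {X Y : Set} {RelX : RTerm X → RTerm X → Set} {RelY : RTerm Y → RTerm Y → Set}
         (σ : X → RTerm Y)
         (σ-resp : ∀ {s t} → RelX s t → RingEq RelY (substitute σ s) (substitute σ t)) where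

  substitute-cong : ∀ {s t} → RingEq RelX s t → RingEq RelY (substitute σ s) (substitute σ t)
  substitute-cong (rel r) = σ-resp r
  substitute-cong r-refl = r-refl
  substitute-cong (r-sym h) = r-sym (substitute-cong h)
  substitute-cong (r-trans h h′) = r-trans (substitute-cong h) (substitute-cong h′)
  substitute-cong (+r-cong h h′) = +r-cong (substitute-cong h) (substitute-cong h′)
  substitute-cong (*r-cong h h′) = *r-cong (substitute-cong h) (substitute-cong h′)
  substitute-cong (-r-cong h) = -r-cong (substitute-cong h)
  substitute-cong (+r-assoc a b c) = +r-assoc _ _ _
  substitute-cong (+r-comm a b) = +r-comm _ _
  substitute-cong (+r-identityˡ a) = +r-identityˡ _
  substitute-cong (-r-inverseˡ a) = -r-inverseˡ _
  substitute-cong (*r-assoc a b c) = *r-assoc _ _ _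
  substitute-cong (*r-comm a b) = *r-comm _ _
  substitute-cong (*r-identityˡ a) = *r-identityˡ _
  substitute-cong (*r-distribˡ a b c) = *r-distribˡ _ _ _

module CommutativeRingLemmas (R : CommutativeRing 0ℓ 0ℓ) where
  open CommutativeRing R public
  open SetoidReasoning setoid
  open RingSolver (fromCommutativeRing R (λ _ → nothing)) using (solve; _⊕_; _⊗_; _⊜_)
  private
    module +G = GroupProperties +-group
    module RP = RingProperties ring

  Null : Carrier → Carrier → Carrier → Set
  Null x y z = (x + y) + z ≈ 0#

  null-cong : ∀ {x x′ y y′ z z′} → x ≈ x′ → y ≈ y′ → z ≈ z′ →
              Null x y z → Null x′ y′ z′
  null-cong ex ey ez h = trans (sym (+-cong (+-cong ex ey) ez)) h

  null-swap₁₂ : ∀ {x y z} → Null x y z → Null y x z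
  null-swap₁₂ {x} {y} {z} =
    trans (solve 3 (λ x y z → ((y ⊕ x) ⊕ z) ⊜ ((x ⊕ y) ⊕ z)) refl x y z)

  null-swap₂₃ : ∀ {x y z} → Null x y z → Null x z y
  null-swap₂₃ {x} {y} {z} =
    trans (solve 3 (λ x y z → ((x ⊕ z) ⊕ y) ⊜ ((x ⊕ y) ⊕ z)) refl x y z)

  null-scale : ∀ u {x y z} → Null x y z → Null (u * x) (u * y) (u * z)
  null-scale u {x} {y} {z} h = begin
    (u * x + u * y) + u * z
      ≈⟨ solve 4 (λ u x y z → (((u ⊗ x) ⊕ (u ⊗ y)) ⊕ (u ⊗ z)) ⊜ (u ⊗ ((x ⊕ y) ⊕ z)))
               refl u x y z ⟩
    u * ((x + y) + z) ≈⟨ *-congˡ h ⟩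
    u * 0#            ≈⟨ zeroʳ u ⟩
    0#                ∎

  Null-0⇒x+y≈0 : ∀ {x y} → Null x y 0# → x + y ≈ 0#
  Null-0⇒x+y≈0 = trans (sym (+-identityʳ _))

  x+y≈0⇒Null-0 : ∀ {x y} → x + y ≈ 0# → Null x y 0#
  x+y≈0⇒Null-0 = trans (+-identityʳ _)

  x+y≈0⇒y≈-x : ∀ {x y} → x + y ≈ 0# → y ≈ - x
  x+y≈0⇒y≈-x = RP.+-inverseʳ-unique _ _

  Null-0⇒y≈-1*x : ∀ {x y} → Null x y 0# → y ≈ - 1# * x
  Null-0⇒y≈-1*x {x} {y} h =
    trans (x+y≈0⇒y≈-x (Null-0⇒x+y≈0 h)) (sym (RP.-1*x≈-x x))

  x-y≈0⇒x≈y : ∀ {x y} → x + - y ≈ 0# → x ≈ y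
  x-y≈0⇒x≈y = +G.x∙y⁻¹≈ε⇒x≈y _ _

  -1*-1≈1 : - 1# * - 1# ≈ 1#
  -1*-1≈1 = trans (RP.-1*x≈-x (- 1#)) (+G.⁻¹-involutive 1#)

  *-exchange : ∀ a b c d → (a * b) * (c * d) ≈ (a * c) * (b * d)
  *-exchange = solve 4 (λ a b c d → ((a ⊗ b) ⊗ (c ⊗ d)) ⊜ ((a ⊗ c) ⊗ (b ⊗ d))) refl

  *-inverse-cong : ∀ {a a′ b b′} → a * a′ ≈ 1# → b * b′ ≈ 1# → a ≈ b → a′ ≈ b′
  *-inverse-cong {a} {a′} {b} {b′} aa′≈1 bb′≈1 a≈b = begin
    a′              ≈⟨ *-identityʳ a′ ⟨
    a′ * 1#         ≈⟨ *-congˡ bb′≈1 ⟨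
    a′ * (b * b′)   ≈⟨ *-assoc a′ b b′ ⟨
    (a′ * b) * b′   ≈⟨ *-congʳ (*-congˡ a≈b) ⟨
    (a′ * a) * b′   ≈⟨ *-congʳ (trans (*-comm a′ a) aa′≈1) ⟩
    1# * b′         ≈⟨ *-identityˡ b′ ⟩
    b′              ∎

  -- A C = A (1 - A′) = A - 1 = - B′, hence A B C = B (A C) = - B B′ = - 1.
  product≈-1 : ∀ {A A′ B B′ C} →
               A * A′ ≈ 1# → A′ + C ≈ 1# → A + B′ ≈ 1# → B * B′ ≈ 1# →
               (A * B) * C ≈ - 1#
  product≈-1 {A} {A′} {B} {B′} {C} AA′≈1 A′+C≈1 A+B′≈1 BB′≈1 = begin
    (A * B) * C   ≈⟨ *-congʳ (*-comm A B) ⟩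
    (B * A) * C   ≈⟨ *-assoc B A C ⟩
    B * (A * C)   ≈⟨ *-congˡ AC≈-B′ ⟩
    B * - B′      ≈⟨ RP.-‿distribʳ-* B B′ ⟨
    - (B * B′)    ≈⟨ -‿cong BB′≈1 ⟩
    - 1#          ∎
    where
    1+AC≈A : 1# + A * C ≈ A
    1+AC≈A = begin
      1# + A * C       ≈⟨ +-congʳ AA′≈1 ⟨
      A * A′ + A * C   ≈⟨ distribˡ A A′ C ⟨
      A * (A′ + C)     ≈⟨ *-congˡ A′+C≈1 ⟩
      A * 1#           ≈⟨ *-identityʳ A ⟩
      A                ∎
    AC≈-B′ : A * C ≈ - B′
    AC≈-B′ = x+y≈0⇒y≈-x (+G.∙-cancelˡ 1# _ _ (begin
      1# + (B′ + A * C)  ≈⟨ +-congˡ (+-comm B′ (A * C)) ⟩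
      1# + (A * C + B′)  ≈⟨ +-assoc 1# (A * C) B′ ⟨
      (1# + A * C) + B′  ≈⟨ +-congʳ 1+AC≈A ⟩
      A + B′             ≈⟨ A+B′≈1 ⟩
      1#                 ≈⟨ +-identityʳ 1# ⟨
      1# + 0#            ∎))

module PastureLemmas (P : Pasture) where
  open Pasture P
  open IsEquivalence ≈-isEquivalence public renaming (refl to ≈-refl; sym to ≈-sym; trans to ≈-trans)

  setoid : Setoid 0ℓ 0ℓ
  setoid = record { isEquivalence = ≈-isEquivalence }

  open SetoidReasoning setoid

  ·-identityʳ : ∀ a → (a · 1#) ≈ a
  ·-identityʳ a = ≈-trans (·-comm a 1#) (·-identityˡ a)

  ·-zeroʳ : ∀ a → (a · 0#) ≈ 0#
  ·-zeroʳ a = ≈-trans (·-comm a 0#) (·-zeroˡ a)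

  ⁻¹-inverseˡ : ∀ a → ¬ a ≈ 0# → ((a ⁻¹) · a) ≈ 1#
  ⁻¹-inverseˡ a a≉0 = ≈-trans (·-comm _ _) (⁻¹-inverse a a≉0)

  ·-commutativeMonoid : CommutativeMonoid 0ℓ 0ℓ
  ·-commutativeMonoid = record
    { isCommutativeMonoid = record
      { isMonoid = record
        { isSemigroup = record
          { isMagma = record { isEquivalence = ≈-isEquivalence ; ∙-cong = ·-cong }
          ; assoc = ·-assoc }
        ; identity = ·-identityˡ , ·-identityʳ }
      ; comm = ·-comm } }

  ·-nonzero : ∀ {a b} → ¬ a ≈ 0# → ¬ b ≈ 0# → ¬ ((a · b) ≈ 0#)
  ·-nonzero {a} {b} a≉0 b≉0 ab≈0 = b≉0 (begin
    b                 ≈⟨ ·-identityˡ b ⟨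
    1# · b            ≈⟨ ·-cong (⁻¹-inverseˡ a a≉0) ≈-refl ⟨
    ((a ⁻¹) · a) · b  ≈⟨ ·-assoc _ _ _ ⟩
    (a ⁻¹) · (a · b)  ≈⟨ ·-cong ≈-refl ab≈0 ⟩
    (a ⁻¹) · 0#       ≈⟨ ·-zeroʳ _ ⟩
    0#                ∎)

  ⁻¹-nonzero : ∀ {a} → ¬ a ≈ 0# → ¬ ((a ⁻¹) ≈ 0#)
  ⁻¹-nonzero {a} a≉0 a⁻¹≈0 =
    1≉0 (≈-trans (≈-sym (⁻¹-inverse a a≉0))
                 (≈-trans (·-cong ≈-refl a⁻¹≈0) (·-zeroʳ a)))

  ⁻¹-cong : ∀ {a a′} → ¬ a ≈ 0# → ¬ a′ ≈ 0# → a ≈ a′ → (a ⁻¹) ≈ (a′ ⁻¹)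
  ⁻¹-cong {a} {a′} a≉0 a′≉0 a≈a′ = begin
    a ⁻¹                     ≈⟨ ·-identityʳ _ ⟨
    (a ⁻¹) · 1#              ≈⟨ ·-cong ≈-refl (⁻¹-inverse a′ a′≉0) ⟨
    (a ⁻¹) · (a′ · (a′ ⁻¹))  ≈⟨ ·-assoc _ _ _ ⟨
    ((a ⁻¹) · a′) · (a′ ⁻¹)  ≈⟨ ·-cong (·-cong ≈-refl a≈a′) ≈-refl ⟨
    ((a ⁻¹) · a) · (a′ ⁻¹)   ≈⟨ ·-cong (⁻¹-inverseˡ a a≉0) ≈-refl ⟩
    1# · (a′ ⁻¹)             ≈⟨ ·-identityˡ _ ⟩
    a′ ⁻¹                    ∎

  N-x-y-0⇒y≈neg·x : ∀ {a b} → ¬ a ≈ 0# → N a b 0# → b ≈ (neg · a)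
  N-x-y-0⇒y≈neg·x {a} {b} a≉0 h = begin
    b                 ≈⟨ ·-identityˡ b ⟨
    1# · b            ≈⟨ ·-cong (⁻¹-inverse a a≉0) ≈-refl ⟨
    (a · (a ⁻¹)) · b  ≈⟨ ·-assoc _ _ _ ⟩
    a · ((a ⁻¹) · b)  ≈⟨ ·-cong ≈-refl a⁻¹b≈neg ⟩
    a · neg           ≈⟨ ·-comm _ _ ⟩
    neg · a           ∎
    where
    b≉0 : ¬ b ≈ 0#
    b≉0 b≈0 = a≉0 (N-zero⇒ (N-resp ≈-refl b≈0 ≈-refl h))
    a⁻¹b≈neg : ((a ⁻¹) · b) ≈ neg
    a⁻¹b≈neg = neg-unique (·-nonzero (⁻¹-nonzero a≉0) b≉0)
      (N-resp (⁻¹-inverseˡ a a≉0) ≈-refl (·-zeroʳ _) (N-scale (⁻¹-nonzero a≉0) h))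

  neg·neg≈1 : (neg · neg) ≈ 1#
  neg·neg≈1 = ≈-sym (N-x-y-0⇒y≈neg·x neg≉0 (N-swap₁₂ N-neg))

  -- Scaling a + b⁻¹ - 1 by -a⁻¹ gives -1 - a⁻¹b⁻¹ + a⁻¹, and -a⁻¹b⁻¹ = c.
  a+b⁻¹≈1⇒a⁻¹+c≈1 : ∀ {a b c} → ¬ a ≈ 0# → ¬ b ≈ 0# →
                    N a (b ⁻¹) neg → ((a · b) · c) ≈ neg → N (a ⁻¹) c neg
  a+b⁻¹≈1⇒a⁻¹+c≈1 {a} {b} {c} a≉0 b≉0 h abc≈neg =
    N-swap₁₂ (N-swap₂₃ (N-swap₁₂ (N-resp ua≈neg ub⁻¹≈c uneg≈a⁻¹ (N-scale u≉0 h))))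
    where
    open CommutativeMonoidSolver ·-commutativeMonoid using (solve; _⊜_; _⊕_)
    u : Carrier
    u = neg · (a ⁻¹)
    u≉0 : ¬ u ≈ 0#
    u≉0 = ·-nonzero neg≉0 (⁻¹-nonzero a≉0)
    ua≈neg : (u · a) ≈ neg
    ua≈neg = begin
      (neg · (a ⁻¹)) · a ≈⟨ ·-assoc _ _ _ ⟩
      neg · ((a ⁻¹) · a) ≈⟨ ·-cong ≈-refl (⁻¹-inverseˡ a a≉0) ⟩
      neg · 1#           ≈⟨ ·-identityʳ neg ⟩
      neg                ∎
    uneg≈a⁻¹ : (u · neg) ≈ (a ⁻¹)
    uneg≈a⁻¹ = begin
      (neg · (a ⁻¹)) · neg
        ≈⟨ solve 2 (λ x y → ((x ⊕ y) ⊕ x) ⊜ ((x ⊕ x) ⊕ y)) ≈-refl neg (a ⁻¹) ⟩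
      (neg · neg) · (a ⁻¹) ≈⟨ ·-cong neg·neg≈1 ≈-refl ⟩
      1# · (a ⁻¹)          ≈⟨ ·-identityˡ _ ⟩
      a ⁻¹                 ∎
    ub⁻¹≈c : (u · (b ⁻¹)) ≈ c
    ub⁻¹≈c = begin
      (neg · (a ⁻¹)) · (b ⁻¹)            ≈⟨ ·-cong (·-cong abc≈neg ≈-refl) ≈-refl ⟨
      (((a · b) · c) · (a ⁻¹)) · (b ⁻¹)
        ≈⟨ solve 5 (λ x y z x′ y′ →
                      ((((x ⊕ y) ⊕ z) ⊕ x′) ⊕ y′) ⊜ (z ⊕ ((x ⊕ x′) ⊕ (y ⊕ y′))))
                 ≈-refl a b c (a ⁻¹) (b ⁻¹) ⟩
      c · ((a · (a ⁻¹)) · (b · (b ⁻¹)))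
        ≈⟨ ·-cong ≈-refl (·-cong (⁻¹-inverse a a≉0) (⁻¹-inverse b b≉0)) ⟩
      c · (1# · 1#)                      ≈⟨ ·-cong ≈-refl (·-identityˡ 1#) ⟩
      c · 1#                             ≈⟨ ·-identityʳ c ⟩
      c                                  ∎

module _ {D E : PastureData} {f : PastureData.Carrier D → PastureData.Carrier E}
         (f-isMorphism : IsMorphism D E f) where
  private
    module UD = Universal D
    module UE = Universal E
  open IsMorphism f-isMorphism

  universalRing-map : ∀ {s t} → s UD.≈R t → substitute (gen ∘ f) s UE.≈R substitute (gen ∘ f) t
  universalRing-map = substitute-cong (gen ∘ f) resp
    where
    resp : ∀ {s t} → UD.URel s t → substitute (gen ∘ f) s UE.≈R substitute (gen ∘ f) t
    resp (UD.ur-cong a≈b) = rel (UE.ur-cong (f-cong a≈b))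
    resp (UD.ur-mul a b) = r-trans (rel (UE.ur-cong (f-mul a b))) (rel (UE.ur-mul _ _))
    resp UD.ur-one = r-trans (rel (UE.ur-cong f-one)) (rel UE.ur-one)
    resp UD.ur-zero = r-trans (rel (UE.ur-cong f-zero)) (rel UE.ur-zero)
    resp (UD.ur-null h) = rel (UE.ur-null (f-null h))

  Π-morphism : IsPartialField E → IsMorphism (Π D) E f
  Π-morphism (injective , nullReflecting) = record
    { f-cong = λ {a} {b} h → injective (f a) (f b) (universalRing-map h)
    ; f-mul = f-mul
    ; f-one = f-one
    ; f-zero = f-zero
    ; f-null = λ {a} {b} {c} h → nullReflecting (f a) (f b) (f c) (universalRing-map h) }

morphism-to-partialField⇒mock : ∀ {D} (P : Pasture) {f : PastureData.Carrier D → Pasture.Carrier P} →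
  IsMorphism D (Pasture.pd P) f → IsPartialField (Pasture.pd P) → IsMockPartialField D
morphism-to-partialField⇒mock {D} P f-isMorphism P-isPartialField 1≈0 =
  1≉0 (≈-trans (≈-sym f-one) (≈-trans (f-cong gen1≈gen0) f-zero))
  where
  open Pasture P using (1≉0)
  open PastureLemmas P using (≈-sym; ≈-trans)
  open IsMorphism (Π-morphism f-isMorphism P-isPartialField)
  open Universal D using (ur-one; ur-zero)
  gen1≈gen0 : Universal._≈R_ D (gen (PastureData.1# D)) (gen (PastureData.0# D))
  gen1≈gen0 = r-trans (rel ur-one) (r-trans 1≈0 (r-sym (rel ur-zero)))

module GRSLift (P : Pasture) where
  open Pasture P using (pd; _≈_; _·_; 0#; N; _⁻¹; neg; ·-cong; ·-assoc; ·-comm;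
    ·-identityˡ; ·-zeroˡ; 1≉0; ⁻¹-inverse; N-resp; N-swap₁₂; N-swap₂₃; N-zero⇐; N-scale;
    neg≉0; N-neg)
  open PastureLemmas P
  open Lifts P

  fundamental : ∀ {a b} → ¬ (a ≈ 0#) → ¬ (b ≈ 0#) → N a b neg → IsFundamental a
  fundamental a≉0 b≉0 h = a≉0 , _ , b≉0 , h

  λm-nonzero : ∀ m → ¬ (λm m ≈ 0#)
  λm-nonzero 1m = 1≉0
  λm-nonzero -1m = neg≉0
  λm-nonzero (tm (a , a≉0 , _)) = a≉0
  λm-nonzero (m ·m n) = ·-nonzero (λm-nonzero m) (λm-nonzero n)
  λm-nonzero (invm m) = ⁻¹-nonzero (λm-nonzero m)

  λE-mul : ∀ x y → λE (x *M y) ≈ (λE x · λE y)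
  λE-mul nothing y = ≈-sym (·-zeroˡ _)
  λE-mul (just m) nothing = ≈-sym (·-zeroʳ _)
  λE-mul (just m) (just n) = ≈-refl

  λm-cong : ∀ {m n} → m ≈G n → λm m ≈ λm n
  λE-cong : ∀ {x y} → x ≈E y → λE x ≈ λE y
  λE-null : ∀ {x y z} → NG x y z → N (λE x) (λE y) (λE z)

  λm-cong g-refl = ≈-refl
  λm-cong (g-sym h) = ≈-sym (λm-cong h)
  λm-cong (g-trans h h′) = ≈-trans (λm-cong h) (λm-cong h′)
  λm-cong (g-·-cong h h′) = ·-cong (λm-cong h) (λm-cong h′)
  λm-cong (g-inv-cong {m} {m′} h) = ⁻¹-cong (λm-nonzero m) (λm-nonzero m′) (λm-cong h)
  λm-cong (g-assoc m n o) = ·-assoc _ _ _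
  λm-cong (g-comm m n) = ·-comm _ _
  λm-cong (g-idˡ m) = ·-identityˡ _
  λm-cong (g-invˡ m) = ⁻¹-inverseˡ _ (λm-nonzero m)
  λm-cong g-negneg = neg·neg≈1
  λm-cong (g-gen p p′ a≈a′) = a≈a′
  λm-cong (g-null {m} h) = N-x-y-0⇒y≈neg·x (λm-nonzero m) (λE-null h)

  λE-cong e-zero = ≈-refl
  λE-cong (e-just h) = λm-cong h

  λE-null n-000 = N-zero⇐ ≈-refl
  λE-null n-neg = N-neg
  λE-null (n-rel (G1 neg≈1)) = N-resp ≈-refl neg≈1 ≈-refl N-neg
  λE-null (n-rel (G2 {a} p q)) = N-resp (≈-sym (⁻¹-inverse a (proj₁ p))) ≈-refl ≈-refl N-neg
  λE-null (n-rel (G3 p q h)) = h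
  λE-null (n-rel (G4 p q r h abc≈neg)) = N-resp (≈-sym abc≈neg) ≈-refl ≈-refl (N-swap₁₂ N-neg)
  λE-null (n-rel (G5 p q r abc≈1)) = N-resp (≈-sym abc≈1) ≈-refl ≈-refl N-neg
  λE-null (n-scale {x} {y} {z} u h) =
    N-resp (≈-sym (λE-mul (just u) x)) (≈-sym (λE-mul (just u) y)) (≈-sym (λE-mul (just u) z))
      (N-scale (λm-nonzero u) (λE-null h))
  λE-null (n-swap₁₂ h) = N-swap₁₂ (λE-null h)
  λE-null (n-swap₂₃ h) = N-swap₂₃ (λE-null h)
  λE-null (n-resp x≈x′ h) = N-resp (λE-cong x≈x′) ≈-refl ≈-refl (λE-null h)

  λG-isMorphism : IsMorphism LG pd λG
  λG-isMorphism = record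
    { f-cong = λE-cong ; f-mul = λE-mul ; f-one = ≈-refl ; f-zero = ≈-refl ; f-null = λE-null }

  module R′ = CommutativeRingLemmas (RingEq-commutativeRing PRel)

  ev*evInv≈1 : ∀ m → (ev m *r evInv m) ≈P' 1r
  ev*evInv≈1 1m = R′.*-identityˡ 1r
  ev*evInv≈1 -1m = R′.-1*-1≈1
  ev*evInv≈1 (tm x) = rel (laurent x)
  ev*evInv≈1 (m ·m n) = R′.trans (R′.*-exchange (ev m) (ev n) (evInv m) (evInv n))
    (R′.trans (R′.*-cong (ev*evInv≈1 m) (ev*evInv≈1 n)) (R′.*-identityˡ 1r))
  ev*evInv≈1 (invm m) = R′.trans (R′.*-comm _ _) (ev*evInv≈1 m)

  evE-mul : ∀ x y → evE (x *M y) ≈P' (evE x *r evE y)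
  evE-mul nothing y = R′.sym (R′.zeroˡ _)
  evE-mul (just m) nothing = R′.sym (R′.zeroʳ _)
  evE-mul (just m) (just n) = R′.refl

  ev-G4 : ∀ {a b c} (p : IsFundamental a) (q : IsFundamental b) (r : IsFundamental c) →
          N a (b ⁻¹) neg → ((a · b) · c) ≈ neg →
          ((T (a , p) *r T (b , q)) *r T (c , r)) ≈P' (-r 1r)
  ev-G4 {a} {b} {c} p@(a≉0 , _) q@(b≉0 , _) r@(c≉0 , _) h abc≈neg = R′.product≈-1
    (R′.x-y≈0⇒x≈y (rel (P2 p a⁻¹-fundamental)))
    (R′.x-y≈0⇒x≈y (rel (P3 a⁻¹-fundamental r a⁻¹+c≈1)))
    (R′.x-y≈0⇒x≈y (rel (P3 p b⁻¹-fundamental h)))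
    (R′.x-y≈0⇒x≈y (rel (P2 q b⁻¹-fundamental)))
    where
    a⁻¹+c≈1 : N (a ⁻¹) c neg
    a⁻¹+c≈1 = a+b⁻¹≈1⇒a⁻¹+c≈1 a≉0 b≉0 h abc≈neg
    a⁻¹-fundamental : IsFundamental (a ⁻¹)
    a⁻¹-fundamental = fundamental (⁻¹-nonzero a≉0) c≉0 a⁻¹+c≈1
    b⁻¹-fundamental : IsFundamental (b ⁻¹)
    b⁻¹-fundamental = fundamental (⁻¹-nonzero b≉0) a≉0 (N-swap₁₂ h)

  ev-cong : ∀ {m n} → m ≈G n → ev m ≈P' ev n
  evE-cong : ∀ {x y} → x ≈E y → evE x ≈P' evE y
  evE-null : ∀ {x y z} → NG x y z → R′.Null (evE x) (evE y) (evE z)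

  ev-cong g-refl = R′.refl
  ev-cong (g-sym h) = R′.sym (ev-cong h)
  ev-cong (g-trans h h′) = R′.trans (ev-cong h) (ev-cong h′)
  ev-cong (g-·-cong h h′) = R′.*-cong (ev-cong h) (ev-cong h′)
  ev-cong (g-inv-cong {m} {m′} h) = R′.*-inverse-cong (ev*evInv≈1 m) (ev*evInv≈1 m′) (ev-cong h)
  ev-cong (g-assoc m n o) = R′.*-assoc _ _ _
  ev-cong (g-comm m n) = R′.*-comm _ _
  ev-cong (g-idˡ m) = R′.*-identityˡ _
  ev-cong (g-invˡ m) = R′.trans (R′.*-comm _ _) (ev*evInv≈1 m)
  ev-cong g-negneg = R′.-1*-1≈1
  ev-cong (g-gen p p′ a≈a′) = rel (p-gen p p′ a≈a′)
  ev-cong (g-null h) = R′.Null-0⇒y≈-1*x (evE-null h)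

  evE-cong e-zero = R′.refl
  evE-cong (e-just h) = ev-cong h

  evE-null n-000 = R′.x+y≈0⇒Null-0 (R′.+-identityʳ 0r)
  evE-null n-neg = R′.x+y≈0⇒Null-0 (R′.-‿inverseʳ 1r)
  evE-null (n-rel (G1 neg≈1)) = R′.x+y≈0⇒Null-0 (rel (P1 neg≈1))
  evE-null (n-rel (G2 p q)) = R′.x+y≈0⇒Null-0 (rel (P2 p q))
  evE-null (n-rel (G3 p q h)) = rel (P3 p q h)
  evE-null (n-rel (G4 p q r h abc≈neg)) =
    R′.x+y≈0⇒Null-0 (R′.trans (R′.+-congʳ (ev-G4 p q r h abc≈neg)) (R′.-‿inverseˡ 1r))
  evE-null (n-rel (G5 p q r abc≈1)) = R′.x+y≈0⇒Null-0 (rel (P4 p q r abc≈1))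
  evE-null (n-scale {x} {y} {z} u h) =
    R′.null-cong (R′.sym (evE-mul (just u) x))
                 (R′.sym (evE-mul (just u) y))
                 (R′.sym (evE-mul (just u) z))
      (R′.null-scale (ev u) (evE-null h))
  evE-null (n-swap₁₂ h) = R′.null-swap₁₂ (evE-null h)
  evE-null (n-swap₂₃ h) = R′.null-swap₂₃ (evE-null h)
  evE-null (n-resp x≈x′ h) = R′.null-cong (evE-cong x≈x′) R′.refl R′.refl (evE-null h)

  evE-isMorphism : IsMorphism LG LP id
  evE-isMorphism = record
    { f-cong = evE-cong
    ; f-mul = λ _ _ → R′.refl
    ; f-one = R′.refl
    ; f-zero = R′.refl
    ; f-null = evE-null }

  LP-isPartialField : IsPartialField LP
  LP-isPartialField = (λ _ _ → evaluate) , (λ _ _ _ → evaluate)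
    where
    module UP = Universal LP
    resp : ∀ {s t} → UP.URel s t → substitute evE s ≈P' substitute evE t
    resp (UP.ur-cong h) = h
    resp (UP.ur-mul x y) = evE-mul x y
    resp UP.ur-one = R′.refl
    resp UP.ur-zero = R′.refl
    resp (UP.ur-null h) = h
    evaluate : ∀ {s t} → s UP.≈R t → substitute evE s ≈P' substitute evE t
    evaluate = substitute-cong evE resp

  module UG = Universal LG
  module RG = CommutativeRingLemmas (RingEq-commutativeRing UG.URel)

  monomial-abelianGroup : AbelianGroup 0ℓ 0ℓ
  monomial-abelianGroup = record
    { Carrier = Mono ; _≈_ = _≈G_ ; _∙_ = _·m_ ; ε = 1m ; _⁻¹ = invm
    ; isAbelianGroup = record
      { isGroup = record
        { isMonoid = record
          { isSemigroup = record
            { isMagma = record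
              { isEquivalence = record { refl = g-refl ; sym = g-sym ; trans = g-trans }
              ; ∙-cong = g-·-cong }
            ; assoc = g-assoc }
          ; identity = g-idˡ , λ m → g-trans (g-comm m 1m) (g-idˡ m) }
        ; inverse = g-invˡ , λ m → g-trans (g-comm m (invm m)) (g-invˡ m)
        ; ⁻¹-cong = g-inv-cong }
      ; comm = g-comm } }

  private
    module MG = GroupProperties (AbelianGroup.group monomial-abelianGroup)
    module MA = AbelianGroupProperties monomial-abelianGroup

  gen-1m : gen (just 1m) RG.≈ 1r
  gen-1m = rel UG.ur-one

  gen-0 : gen nothing RG.≈ 0r
  gen-0 = rel UG.ur-zero

  gen-·m : ∀ m n → gen (just (m ·m n)) RG.≈ (gen (just m) *r gen (just n))
  gen-·m m n = rel (UG.ur-mul (just m) (just n))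

  gen-cong : ∀ {m n} → m ≈G n → gen (just m) RG.≈ gen (just n)
  gen-cong h = rel (UG.ur-cong (e-just h))

  gen-null : ∀ {x y z} → NG x y z → RG.Null (gen x) (gen y) (gen z)
  gen-null h = rel (UG.ur-null h)

  gen-null₀ : ∀ {m n} → NG (just m) (just n) nothing → (gen (just m) +r gen (just n)) RG.≈ 0r
  gen-null₀ h = RG.Null-0⇒x+y≈0 (RG.null-cong RG.refl RG.refl gen-0 (gen-null h))

  gen-1m-neg : gen (just -1m) RG.≈ (-r 1r)
  gen-1m-neg = RG.x+y≈0⇒y≈-x (RG.trans (RG.+-congʳ (RG.sym gen-1m)) (gen-null₀ n-neg))

  toLG : Fund ⊎ Fund → RTerm Elt
  toLG (inj₁ x) = gen (just (tm x))
  toLG (inj₂ x) = gen (just (invm (tm x)))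

  toLG-ev : ∀ m → substitute toLG (ev m) RG.≈ gen (just m) ×
                  substitute toLG (evInv m) RG.≈ gen (just (invm m))
  toLG-ev 1m = RG.sym gen-1m , RG.trans (RG.sym gen-1m) (gen-cong (g-sym MG.ε⁻¹≈ε))
  toLG-ev -1m = RG.sym gen-1m-neg
              , RG.trans (RG.sym gen-1m-neg) (gen-cong (MG.inverseʳ-unique -1m -1m g-negneg))
  toLG-ev (tm x) = RG.refl , RG.refl
  toLG-ev (m ·m n) =
    RG.trans (RG.*-cong (proj₁ (toLG-ev m)) (proj₁ (toLG-ev n))) (RG.sym (gen-·m m n)) ,
    RG.trans (RG.*-cong (proj₂ (toLG-ev m)) (proj₂ (toLG-ev n)))
      (RG.trans (RG.sym (gen-·m _ _)) (gen-cong (MA.⁻¹-∙-comm m n)))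
  toLG-ev (invm m) =
    proj₂ (toLG-ev m) , RG.trans (proj₁ (toLG-ev m)) (gen-cong (g-sym (MG.⁻¹-involutive m)))

  toLG-evE : ∀ x → substitute toLG (evE x) RG.≈ gen x
  toLG-evE nothing = RG.sym gen-0
  toLG-evE (just m) = proj₁ (toLG-ev m)

  toLG-resp : ∀ {s t} → PRel s t → substitute toLG s RG.≈ substitute toLG t
  toLG-resp (laurent x) = RG.trans (RG.sym (gen-·m _ _))
    (RG.trans (gen-cong (AbelianGroup.inverseʳ monomial-abelianGroup (tm x))) gen-1m)
  toLG-resp (p-gen p p′ a≈a′) = gen-cong (g-gen p p′ a≈a′)
  toLG-resp (P1 neg≈1) =
    RG.trans (RG.sym (RG.+-cong gen-1m gen-1m)) (gen-null₀ (n-rel (G1 neg≈1)))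
  toLG-resp (P2 p q) =
    RG.trans (RG.sym (RG.+-cong (gen-·m _ _) gen-1m-neg)) (gen-null₀ (n-rel (G2 p q)))
  toLG-resp (P3 p q h) = RG.null-cong RG.refl RG.refl gen-1m-neg (gen-null (n-rel (G3 p q h)))
  toLG-resp (P4 p q r abc≈1) =
    RG.trans (RG.sym (RG.+-cong (RG.trans (gen-·m _ _) (RG.*-cong (gen-·m _ _) RG.refl)) gen-1m-neg))
      (gen-null₀ (n-rel (G5 p q r abc≈1)))

  LP→ΠLG-isMorphism : IsMorphism LP (Π LG) id
  LP→ΠLG-isMorphism = record
    { f-cong = λ {x} {y} h → RG.trans (RG.sym (toLG-evE x)) (RG.trans (lift h) (toLG-evE y))
    ; f-mul = λ _ _ → RG.refl
    ; f-one = RG.refl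
    ; f-zero = RG.refl
    ; f-null = λ {x} {y} {z} h → RG.null-cong (toLG-evE x) (toLG-evE y) (toLG-evE z) (lift h) }
    where
    lift : ∀ {s t} → s ≈P' t → substitute toLG s RG.≈ substitute toLG t
    lift = substitute-cong toLG toLG-resp

  ΠLG≅LP : IsIsomorphism (Π LG) LP id
  ΠLG≅LP = record
    { morphism = Π-morphism evE-isMorphism LP-isPartialField
    ; inverse = id
    ; inverse-morphism = LP→ΠLG-isMorphism
    ; inverseˡ = λ _ → R′.refl
    ; inverseʳ = λ _ → RG.refl }

proposition2p15 : (P : Pasture) → IsPartialField (Pasture.pd P) →
    IsMockPartialField (Lifts.LG P) ×
    Σ (PastureData.Carrier (Π (Lifts.LG P)) → PastureData.Carrier (Lifts.LP P))
      (λ θ → IsIsomorphism (Π (Lifts.LG P)) (Lifts.LP P) θ ×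
             (∀ x → Pasture._≈_ P (Lifts.λG P x) (Lifts.λP P (θ (π (Lifts.LG P) x)))))
proposition2p15 P P-isPartialField =
  morphism-to-partialField⇒mock P λG-isMorphism P-isPartialField , id , ΠLG≅LP , λ _ → ≈-refl
  where
  open GRSLift P using (λG-isMorphism; ΠLG≅LP)
  open PastureLemmas P using (≈-refl)
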